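{- Let $k\geq 3$ and $1\leq r\leq k-1$ be integers and let $G_{k,r}$, $U$ and $\mathcal{X}$ be as defined in the context. If $r<k-1$, then $U$ is the only $\Gamma$-set of $G_{k,r}$, and $\mathcal{X}$ is precisely the collection of $\gamma$-sets of $G_{k,r}$. If $r=k-1$, then $G_{k,r}$ is well-dominated and the sets in $\mathcal{X}\cup\{U\}$ are precisely the $\gamma$-sets (and $\Gamma$-sets) of $G_{k,r}$. Moreover, $G_{k,r}$ has no minimal dominating sets other than $U$ and the sets in $\mathcal{X}$.
   Context: The graph $G_{k,r}$ (for integers $k\geq3$, $1\leq r\leq k-1$) has vertex set $U\cup\{u_0\}\cup V_1\cup\dots\cup V_r$, where $U=\{u_1,\dots,u_k\}$ and $V_i=\{v_{i,1},\dots,v_{i,k}\}$ for $i=1,\dots,r$ (all distinct). Its edges: $U$ is a clique; each $V_i$ is a clique; $u_j$ is adjacent to $v_{i,j}$ for all $i,j$; and $u_0$ is adjacent to every vertex of $U$; there are no other edges. Let $U_0=U\cup\{u_0\}$ and $\mathcal{X}=\{X\subseteq V(G_{k,r}): |X\cap U_0|=1 \text{ and } |X\cap V_i|=1 \text{ for each } i=1,\dots,r\}$. $\gamma(G)$ and $\Gamma(G)$ are the minimum cardinality of a dominating set and the maximum cardinality of a minimal dominating set; a $\gamma$-set is a dominating set of cardinality $\gamma(G)$, a $\Gamma$-set is a minimal dominating set of cardinality $\Gamma(G)$; $G$ is well-dominated if $\gamma(G)=\Gamma(G)$. -}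

module Defs where

open import Data.Nat using (ℕ; zero; suc; _+_; _≤_)
open import Data.Fin using (Fin)
open import Data.List using (List; []; _∷_; map; _++_; concatMap; allFin)
open import Data.Nat.ListAction using (sum)
open import Data.Bool using (Bool; true; false; if_then_else_)
open import Data.Product using (Σ; _×_; ∃-syntax)
open import Data.Sum using (_⊎_)
open import Relation.Binary.PropositionalEquality using (_≡_; _≢_)
open import Relation.Nullary using (¬_)

-- A graph is given by a vertex type V, an adjacency relation Adj, and a
-- list `vs` enumerating every vertex exactly once.

module Domination (V : Set) (Adj : V → V → Set) (vs : List V) where

  VSet : Set
  VSet = V → Bool

  _∈ˢ_ : V → VSet → Set
  x ∈ˢ S = S x ≡ true

  countIn : List V → VSet → ℕ
  countIn ys S = sum (map (λ x → if S x then 1 else 0) ys)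

  ∣_∣ˢ : VSet → ℕ
  ∣ S ∣ˢ = countIn vs S

  _≐_ : VSet → VSet → Set
  S ≐ T = ∀ x → S x ≡ T x

  _⊆ˢ_ : VSet → VSet → Set
  S ⊆ˢ T = ∀ x → x ∈ˢ S → x ∈ˢ T

  _⊂ˢ_ : VSet → VSet → Set
  S ⊂ˢ T = S ⊆ˢ T × ¬ (S ≐ T)

  Dominating : VSet → Set
  Dominating S = ∀ x → x ∈ˢ S ⊎ (∃[ y ] (y ∈ˢ S × Adj y x))

  MinimalDominating : VSet → Set
  MinimalDominating S = Dominating S × (∀ T → T ⊂ˢ S → ¬ Dominating T)

  IsDominationNumber : ℕ → Set
  IsDominationNumber n =
    (∃[ S ] (Dominating S × ∣ S ∣ˢ ≡ n)) × (∀ T → Dominating T → n ≤ ∣ T ∣ˢ)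

  IsUpperDominationNumber : ℕ → Set
  IsUpperDominationNumber n =
    (∃[ S ] (MinimalDominating S × ∣ S ∣ˢ ≡ n)) × (∀ T → MinimalDominating T → ∣ T ∣ˢ ≤ n)

  γSet : VSet → Set
  γSet S = Dominating S × IsDominationNumber ∣ S ∣ˢ

  ΓSet : VSet → Set
  ΓSet S = MinimalDominating S × IsUpperDominationNumber ∣ S ∣ˢ

  WellDominated : Set
  WellDominated = ∃[ n ] (IsDominationNumber n × IsUpperDominationNumber n)

data Vtx (k r : ℕ) : Set where
  u₀ : Vtx k r
  u  : Fin k → Vtx k r
  v  : Fin r → Fin k → Vtx k r

data Adj {k r : ℕ} : Vtx k r → Vtx k r → Set where
  uu   : ∀ {i j} → i ≢ j → Adj (u i) (u j)
  vv   : ∀ {a i j} → i ≢ j → Adj (v a i) (v a j)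
  uv   : ∀ {a j} → Adj (u j) (v a j)
  vu   : ∀ {a j} → Adj (v a j) (u j)
  u₀u  : ∀ {j} → Adj u₀ (u j)
  uu₀  : ∀ {j} → Adj (u j) u₀

Ulist : (k r : ℕ) → List (Vtx k r)
Ulist k r = map u (allFin k)

U₀list : (k r : ℕ) → List (Vtx k r)
U₀list k r = u₀ ∷ Ulist k r

Vlist : (k r : ℕ) → Fin r → List (Vtx k r)
Vlist k r a = map (v a) (allFin k)

allVtx : (k r : ℕ) → List (Vtx k r)
allVtx k r = U₀list k r ++ concatMap (Vlist k r) (allFin r)

module G (k r : ℕ) = Domination (Vtx k r) Adj (allVtx k r)

Uset : (k r : ℕ) → Vtx k r → Bool
Uset k r (u _) = true
Uset k r _     = false

In𝒳 : (k r : ℕ) → (Vtx k r → Bool) → Set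
In𝒳 k r X = G.countIn k r (U₀list k r) X ≡ 1 × (∀ a → G.countIn k r (Vlist k r a) X ≡ 1)

-- A dominating set S of G_{k,r} either misses some clique V_a, and then it
-- contains all of U (each v_{a,j} can only be dominated by u_j), or it meets
-- U₀ and every V_a, and then it contains a member of 𝒳.  Both U and the members
-- of 𝒳 dominate, so the minimal dominating sets are exactly U and 𝒳; their sizes
-- k and r + 1 give γ = r + 1 and Γ = k, and comparing the two sizes sorts out
-- which of them are γ-sets and Γ-sets.

module Submission where

open import Defs
open import Data.Bool using (Bool; true; false; if_then_else_)
open import Data.Bool.Properties using () renaming (_≟_ to _≟ᵇ_)
open import Data.Empty using (⊥-elim)
open import Data.Fin using (Fin; zero; suc; fromℕ<)
open import Data.Fin.Properties using (_≟_; all?; any?; ¬∀⟶∃¬)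
open import Data.List using (List; []; _∷_; map; _++_; concatMap; allFin; length)
open import Data.List.Membership.Propositional using (_∈_)
open import Data.List.Membership.Propositional.Properties
  using (∈-++⁺ˡ; ∈-++⁺ʳ; ∈-map⁺; ∈-allFin; ∈-concat⁺′)
open import Data.List.Properties using (map-++; map-∘; map-cong; map-tabulate; length-tabulate)
open import Data.List.Relation.Unary.All using (All; []; _∷_) renaming (lookup to All-lookup)
open import Data.List.Relation.Unary.Any using (here; there)
open import Data.Maybe using (Maybe; nothing; just)
open import Data.Nat using (ℕ; zero; suc; _+_; _*_; _∸_; _≤_; _<_; z≤n; s≤s; s≤s⁻¹)
open import Data.Nat.ListAction using (sum)
open import Data.Nat.ListAction.Properties using (sum-++)
open import Data.Nat.Properties
  using ( ≤-trans; ≤-antisym; ≤-reflexive; <-irrefl; m≤n⇒m≤1+n; m<n⇒0<n; suc-injective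
        ; +-identityʳ; *-zeroʳ; *-identityʳ)
open import Data.Product using (_×_; _,_; proj₁; proj₂; ∃-syntax)
open import Data.Sum using (_⊎_; inj₁; inj₂; swap; map₁; map₂; fromInj₁; fromInj₂)
open import Function using (_∘_; id)
open import Function.Bundles using (_⇔_; mk⇔)
open import Function.Properties.Equivalence using () renaming (trans to ⇔-trans)
open import Relation.Binary.PropositionalEquality
  using (_≡_; refl; sym; trans; cong; cong₂; subst; subst₂; _≗_; module ≡-Reasoning)
open import Relation.Nullary using (¬_; yes; no; does)

count : {A : Set} → (A → Bool) → List A → ℕ
count P ys = sum (map (λ x → if P x then 1 else 0) ys)

module _ {A : Set} where

  count-++ : (P : A → Bool) (xs ys : List A) → count P (xs ++ ys) ≡ count P xs + count P ys
  count-++ P xs ys = trans (cong sum (map-++ _ xs ys)) (sum-++ (map _ xs) (map _ ys))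

  count-map : {B : Set} (P : A → Bool) (f : B → A) (ys : List B) →
    count P (map f ys) ≡ count (P ∘ f) ys
  count-map P f ys = cong sum (sym (map-∘ ys))

  count-cong : {P Q : A → Bool} → P ≗ Q → (ys : List A) → count P ys ≡ count Q ys
  count-cong P≗Q ys = cong sum (map-cong (λ x → cong (if_then 1 else 0) (P≗Q x)) ys)

  count-false : (ys : List A) → count (λ _ → false) ys ≡ 0
  count-false []       = refl
  count-false (_ ∷ ys) = count-false ys

  count-true : (ys : List A) → count (λ _ → true) ys ≡ length ys
  count-true []       = refl
  count-true (_ ∷ ys) = cong suc (count-true ys)

  count-concatMap : {B : Set} (P : A → Bool) (f : B → List A) {n : ℕ} →
    (∀ b → count P (f b) ≡ n) → (bs : List B) → count P (concatMap f bs) ≡ length bs * n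
  count-concatMap P f fb≡n []       = refl
  count-concatMap P f fb≡n (b ∷ bs) =
    trans (count-++ P (f b) (concatMap f bs)) (cong₂ _+_ (fb≡n b) (count-concatMap P f fb≡n bs))

  count-mono : {P Q : A → Bool} → (∀ x → P x ≡ true → Q x ≡ true) →
    (ys : List A) → count P ys ≤ count Q ys
  count-mono P⊆Q [] = z≤n
  count-mono {P} {Q} P⊆Q (y ∷ ys) with P y in Py | Q y in Qy
  ... | true  | true  = s≤s (count-mono P⊆Q ys)
  ... | true  | false with () ← trans (sym Qy) (P⊆Q y Py)
  ... | false | true  = m≤n⇒m≤1+n (count-mono P⊆Q ys)
  ... | false | false = count-mono P⊆Q ys

  count-⊆∧≥⇒≡ : {P Q : A → Bool} → (∀ x → P x ≡ true → Q x ≡ true) →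
    (ys : List A) → count Q ys ≤ count P ys → All (λ x → P x ≡ Q x) ys
  count-⊆∧≥⇒≡ P⊆Q [] _ = []
  count-⊆∧≥⇒≡ {P} {Q} P⊆Q (y ∷ ys) Q≤P with P y in Py | Q y in Qy
  ... | true  | true  = trans Py (sym Qy) ∷ count-⊆∧≥⇒≡ P⊆Q ys (s≤s⁻¹ Q≤P)
  ... | true  | false with () ← trans (sym Qy) (P⊆Q y Py)
  ... | false | true  = ⊥-elim (<-irrefl refl (≤-trans Q≤P (count-mono P⊆Q ys)))
  ... | false | false = trans Py (sym Qy) ∷ count-⊆∧≥⇒≡ P⊆Q ys Q≤P

  count-pos⇒∃ : (P : A → Bool) (ys : List A) → 0 < count P ys → ∃[ x ] P x ≡ true
  count-pos⇒∃ P (y ∷ ys) pos with P y in Py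
  ... | true  = y , Py
  ... | false = count-pos⇒∃ P ys pos

count-allFin-suc : ∀ {n} (P : Fin (suc n) → Bool) →
  count P (allFin (suc n)) ≡ (if P zero then 1 else 0) + count (P ∘ suc) (allFin n)
count-allFin-suc {n} P =
  cong ((if P zero then 1 else 0) +_)
    (trans (cong (count P) (sym (map-tabulate {n = n} id suc))) (count-map P suc (allFin n)))

count-allFin-≟ : ∀ {n} (i : Fin n) → count (λ j → does (i ≟ j)) (allFin n) ≡ 1
count-allFin-≟ {suc n} zero    =
  trans (count-allFin-suc {n} (λ j → does (zero ≟ j))) (cong suc (count-false (allFin n)))
count-allFin-≟ {suc n} (suc i) =
  trans (count-allFin-suc {n} (λ j → does (suc i ≟ j))) (count-allFin-≟ i)

module DominationProperties (V : Set) (Adj : V → V → Set) (vs : List V) where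
  open Domination V Adj vs

  ≐-sym : {S T : VSet} → S ≐ T → T ≐ S
  ≐-sym S≐T x = sym (S≐T x)

  ≐⇒⊆ : {S T : VSet} → S ≐ T → S ⊆ˢ T
  ≐⇒⊆ S≐T x x∈S = trans (sym (S≐T x)) x∈S

  ∣∣-resp-≐ : {S T : VSet} → S ≐ T → ∣ S ∣ˢ ≡ ∣ T ∣ˢ
  ∣∣-resp-≐ S≐T = count-cong S≐T vs

  ⊆⇒∣∣≤ : {S T : VSet} → S ⊆ˢ T → ∣ S ∣ˢ ≤ ∣ T ∣ˢ
  ⊆⇒∣∣≤ S⊆T = count-mono S⊆T vs

  ⊆∧∣∣≥⇒≐ : (∀ x → x ∈ vs) → {S T : VSet} → S ⊆ˢ T → ∣ T ∣ˢ ≤ ∣ S ∣ˢ → S ≐ T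
  ⊆∧∣∣≥⇒≐ complete S⊆T T≤S x = All-lookup (count-⊆∧≥⇒≡ S⊆T vs T≤S) (complete x)

  Dominating-mono : {S T : VSet} → S ⊆ˢ T → Dominating S → Dominating T
  Dominating-mono S⊆T D x with D x
  ... | inj₁ x∈S             = inj₁ (S⊆T x x∈S)
  ... | inj₂ (y , y∈S , adj) = inj₂ (y , S⊆T y y∈S , adj)

  MinimalDominating-resp-≐ : {S T : VSet} → S ≐ T → MinimalDominating S → MinimalDominating T
  MinimalDominating-resp-≐ S≐T (D , minimal) =
    Dominating-mono (≐⇒⊆ S≐T) D ,
    λ W (W⊆T , W≉T) → minimal W ((λ x x∈W → ≐⇒⊆ (≐-sym S≐T) x (W⊆T x x∈W)) ,
                                 λ W≐S → W≉T (λ x → trans (W≐S x) (S≐T x)))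

  MinimalDominating-⊆ : {S T : VSet} → MinimalDominating S → T ⊆ˢ S → Dominating T → T ≐ S
  MinimalDominating-⊆ {S} {T} (_ , minimal) T⊆S DT x with T x ≟ᵇ S x
  ... | yes Tx≡Sx = Tx≡Sx
  ... | no  Tx≢Sx = ⊥-elim (minimal T (T⊆S , (λ T≐S → Tx≢Sx (T≐S x))) DT)

  minimum⇒MinimalDominating : (∀ x → x ∈ vs) → {S : VSet} → Dominating S →
    (∀ T → Dominating T → ∣ S ∣ˢ ≤ ∣ T ∣ˢ) → MinimalDominating S
  minimum⇒MinimalDominating complete D minimum =
    D , λ T (T⊆S , T≉S) DT → T≉S (⊆∧∣∣≥⇒≐ complete T⊆S (minimum T DT))

  IsDominationNumber-unique : {m n : ℕ} → IsDominationNumber m → IsDominationNumber n → m ≡ n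
  IsDominationNumber-unique ((S , DS , ∣S∣≡m) , m≤) ((T , DT , ∣T∣≡n) , n≤) =
    ≤-antisym (subst (_ ≤_) ∣T∣≡n (m≤ T DT)) (subst (_ ≤_) ∣S∣≡m (n≤ S DS))

  IsUpperDominationNumber-unique : {m n : ℕ} →
    IsUpperDominationNumber m → IsUpperDominationNumber n → m ≡ n
  IsUpperDominationNumber-unique ((S , MS , ∣S∣≡m) , ≤m) ((T , MT , ∣T∣≡n) , ≤n) =
    ≤-antisym (subst (_≤ _) ∣S∣≡m (≤n S MS)) (subst (_≤ _) ∣T∣≡n (≤m T MT))

  γSet⇔ : {n : ℕ} → IsDominationNumber n → ∀ S → γSet S ⇔ (Dominating S × ∣ S ∣ˢ ≡ n)
  γSet⇔ γ≡n S = mk⇔ (λ (D , γ≡∣S∣) → D , IsDominationNumber-unique γ≡∣S∣ γ≡n)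
                    (λ (D , ∣S∣≡n) → D , subst IsDominationNumber (sym ∣S∣≡n) γ≡n)

  ΓSet⇔ : {n : ℕ} → IsUpperDominationNumber n → ∀ S → ΓSet S ⇔ (MinimalDominating S × ∣ S ∣ˢ ≡ n)
  ΓSet⇔ Γ≡n S = mk⇔ (λ (M , Γ≡∣S∣) → M , IsUpperDominationNumber-unique Γ≡∣S∣ Γ≡n)
                    (λ (M , ∣S∣≡n) → M , subst IsUpperDominationNumber (sym ∣S∣≡n) Γ≡n)

module Properties (k r : ℕ) where
  open G k r
  open DominationProperties (Vtx k r) Adj (allVtx k r)

  allVtx-complete : ∀ x → x ∈ allVtx k r
  allVtx-complete u₀      = here refl
  allVtx-complete (u j)   = there (∈-++⁺ˡ (∈-map⁺ u (∈-allFin j)))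
  allVtx-complete (v a j) =
    ∈-++⁺ʳ (U₀list k r) (∈-concat⁺′ (∈-map⁺ (v a) (∈-allFin j)) (∈-map⁺ (Vlist k r) (∈-allFin a)))

  ∣∣-parts : (S : VSet) {n : ℕ} → (∀ a → countIn (Vlist k r a) S ≡ n) →
    ∣ S ∣ˢ ≡ countIn (U₀list k r) S + r * n
  ∣∣-parts S {n} Va≡n =
    trans (count-++ S (U₀list k r) (concatMap (Vlist k r) (allFin r)))
          (cong (countIn (U₀list k r) S +_)
                (trans (count-concatMap S (Vlist k r) Va≡n (allFin r))
                       (cong (_* n) (length-tabulate {n = r} id))))

  ∣U∣≡k : ∣ Uset k r ∣ˢ ≡ k
  ∣U∣≡k = begin
    ∣ Uset k r ∣ˢ                            ≡⟨ ∣∣-parts (Uset k r) Va≡0 ⟩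
    countIn (Ulist k r) (Uset k r) + r * 0 ≡⟨ cong₂ _+_ (count-map (Uset k r) u (allFin k)) (*-zeroʳ r) ⟩
    count (λ _ → true) (allFin k) + 0      ≡⟨ +-identityʳ _ ⟩
    count (λ _ → true) (allFin k)          ≡⟨ count-true (allFin k) ⟩
    length (allFin k)                      ≡⟨ length-tabulate id ⟩
    k                                      ∎
    where
    open ≡-Reasoning
    Va≡0 : ∀ a → countIn (Vlist k r a) (Uset k r) ≡ 0
    Va≡0 a = trans (count-map (Uset k r) (v a) (allFin k)) (count-false (allFin k))

  In𝒳⇒∣∣≡ : {S : VSet} → In𝒳 k r S → ∣ S ∣ˢ ≡ suc r
  In𝒳⇒∣∣≡ {S} (U₀≡1 , Va≡1) = trans (∣∣-parts S Va≡1) (cong₂ _+_ U₀≡1 (*-identityʳ r))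

  In𝒳-resp-≐ : {S T : VSet} → S ≐ T → In𝒳 k r S → In𝒳 k r T
  In𝒳-resp-≐ S≐T (U₀≡1 , Va≡1) =
    trans (sym (count-cong S≐T (U₀list k r))) U₀≡1 ,
    λ a → trans (sym (count-cong S≐T (Vlist k r a))) (Va≡1 a)

  hub : Maybe (Fin k) → Vtx k r
  hub nothing  = u₀
  hub (just j) = u j

  MeetsAllParts : VSet → Set
  MeetsAllParts S = (∃[ w ] hub w ∈ˢ S) × (∀ a → ∃[ j ] v a j ∈ˢ S)

  MeetsAllParts⇒Dominating : {S : VSet} → MeetsAllParts S → Dominating S
  MeetsAllParts⇒Dominating ((nothing , p) , _) u₀ = inj₁ p
  MeetsAllParts⇒Dominating ((just i  , p) , _) u₀ = inj₂ (u i , p , uu₀)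
  MeetsAllParts⇒Dominating ((nothing , p) , _) (u j) = inj₂ (u₀ , p , u₀u)
  MeetsAllParts⇒Dominating ((just i  , p) , _) (u j) with i ≟ j
  ... | yes refl = inj₁ p
  ... | no  i≢j  = inj₂ (u i , p , uu i≢j)
  MeetsAllParts⇒Dominating (_ , meetsV) (v a j) with meetsV a
  ... | i , p with i ≟ j
  ... | yes refl = inj₁ p
  ... | no  i≢j  = inj₂ (v a i , p , vv i≢j)

  In𝒳⇒MeetsAllParts : {S : VSet} → In𝒳 k r S → MeetsAllParts S
  In𝒳⇒MeetsAllParts {S} (U₀≡1 , Va≡1) = meetsU₀ , meetsV
    where
    meetsU₀ : ∃[ w ] hub w ∈ˢ S
    meetsU₀ with S u₀ in S∋u₀
    ... | true  = nothing , S∋u₀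
    ... | false with count-pos⇒∃ (S ∘ u) (allFin k)
                       (subst (0 <_) (count-map S u (allFin k)) (≤-reflexive (sym U₀≡1)))
    ... | j , p = just j , p
    meetsV : ∀ a → ∃[ j ] v a j ∈ˢ S
    meetsV a = count-pos⇒∃ (S ∘ v a) (allFin k)
                 (subst (0 <_) (count-map S (v a) (allFin k)) (≤-reflexive (sym (Va≡1 a))))

  In𝒳⇒Dominating : {S : VSet} → In𝒳 k r S → Dominating S
  In𝒳⇒Dominating = MeetsAllParts⇒Dominating ∘ In𝒳⇒MeetsAllParts

  X : Maybe (Fin k) → (Fin r → Fin k) → VSet
  X w        c (v a j) = does (c a ≟ j)
  X nothing  c u₀      = true
  X (just i) c u₀      = false
  X nothing  c (u j)   = false
  X (just i) c (u j)   = does (i ≟ j)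

  X-In𝒳 : ∀ w c → In𝒳 k r (X w c)
  X-In𝒳 w c = U₀≡1 w , Va≡1
    where
    Va≡1 : ∀ a → countIn (Vlist k r a) (X w c) ≡ 1
    Va≡1 a = trans (count-map (X w c) (v a) (allFin k)) (count-allFin-≟ (c a))
    U₀≡1 : ∀ w → countIn (U₀list k r) (X w c) ≡ 1
    U₀≡1 nothing  = cong suc (trans (count-map (X nothing c) u (allFin k)) (count-false (allFin k)))
    U₀≡1 (just i) = trans (count-map (X (just i) c) u (allFin k)) (count-allFin-≟ i)

  MeetsAllParts⇒𝒳-subset : {S : VSet} → MeetsAllParts S → ∃[ T ] In𝒳 k r T × T ⊆ˢ S
  MeetsAllParts⇒𝒳-subset {S} ((w , w∈S) , meetsV) = X w c , X-In𝒳 w c , X⊆S w w∈S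
    where
    c : Fin r → Fin k
    c a = proj₁ (meetsV a)
    X⊆S : ∀ w → hub w ∈ˢ S → X w c ⊆ˢ S
    X⊆S nothing  w∈S u₀ _ = w∈S
    X⊆S (just i) w∈S (u j) _ with i ≟ j
    ... | yes refl = w∈S
    X⊆S w        _   (v a j) _ with c a ≟ j
    ... | yes refl = proj₂ (meetsV a)

  Dominating⇒U⊆⊎𝒳-subset : {S : VSet} → Dominating S →
    Uset k r ⊆ˢ S ⊎ ∃[ T ] In𝒳 k r T × T ⊆ˢ S
  Dominating⇒U⊆⊎𝒳-subset {S} D with all? (λ a → any? (λ j → S (v a j) ≟ᵇ true))
  ... | yes meetsV = inj₂ (MeetsAllParts⇒𝒳-subset (meetsU₀ , meetsV))
    where
    meetsU₀ : ∃[ w ] hub w ∈ˢ S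
    meetsU₀ with D u₀
    ... | inj₁ u₀∈S                = nothing , u₀∈S
    ... | inj₂ (u j , uj∈S , uu₀) = just j , uj∈S
  ... | no ¬meetsV with ¬∀⟶∃¬ r _ (λ a → any? (λ j → S (v a j) ≟ᵇ true)) ¬meetsV
  ... | a , missesVa = inj₁ U⊆S
    where
    -- v_{a,j} ∉ S, and its only neighbour outside V_a is u_j.
    U⊆S : Uset k r ⊆ˢ S
    U⊆S (u j) _ with D (v a j)
    ... | inj₁ vaj∈S                  = ⊥-elim (missesVa (j , vaj∈S))
    ... | inj₂ (v a i , vai∈S , vv _) = ⊥-elim (missesVa (i , vai∈S))
    ... | inj₂ (u j , uj∈S , uv)      = uj∈S

  U-Dominating : 0 < k → Dominating (Uset k r)
  U-Dominating 0<k u₀      = inj₂ (u (fromℕ< 0<k) , refl , uu₀)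
  U-Dominating 0<k (u j)   = inj₁ refl
  U-Dominating 0<k (v a j) = inj₂ (u j , refl , uv)

  U-MinimalDominating : 0 < k → 0 < r → MinimalDominating (Uset k r)
  U-MinimalDominating 0<k 0<r = U-Dominating 0<k , λ T (T⊆U , T≉U) DT → excluded T⊆U T≉U DT
    where
    -- A member of 𝒳 contains a vertex of V_a, which lies outside U.
    excluded : ∀ {T} → T ⊆ˢ Uset k r → ¬ T ≐ Uset k r → ¬ Dominating T
    excluded {T} T⊆U T≉U DT with Dominating⇒U⊆⊎𝒳-subset DT
    ... | inj₁ U⊆T = T≉U (⊆∧∣∣≥⇒≐ allVtx-complete T⊆U (⊆⇒∣∣≤ U⊆T))
    ... | inj₂ (X′ , X′∈𝒳 , X′⊆T) with proj₂ (In𝒳⇒MeetsAllParts X′∈𝒳) (fromℕ< 0<r)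
    ... | j , vaj∈X′ with () ← T⊆U (v (fromℕ< 0<r) j) (X′⊆T _ vaj∈X′)

  Dominating⇒suc-r≤∣∣ : suc r ≤ k → {S : VSet} → Dominating S → suc r ≤ ∣ S ∣ˢ
  Dominating⇒suc-r≤∣∣ r<k {S} D with Dominating⇒U⊆⊎𝒳-subset D
  ... | inj₁ U⊆S = ≤-trans r<k (subst (_≤ ∣ S ∣ˢ) ∣U∣≡k (⊆⇒∣∣≤ U⊆S))
  ... | inj₂ (T , T∈𝒳 , T⊆S) = subst (_≤ ∣ S ∣ˢ) (In𝒳⇒∣∣≡ T∈𝒳) (⊆⇒∣∣≤ T⊆S)

  In𝒳⇒MinimalDominating : suc r ≤ k → {S : VSet} → In𝒳 k r S → MinimalDominating S
  In𝒳⇒MinimalDominating r<k {S} S∈𝒳 =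
    minimum⇒MinimalDominating allVtx-complete (In𝒳⇒Dominating S∈𝒳)
      (λ T DT → subst (_≤ ∣ T ∣ˢ) (sym (In𝒳⇒∣∣≡ S∈𝒳)) (Dominating⇒suc-r≤∣∣ r<k DT))

  MinimalDominating⇒≐U⊎In𝒳 : 0 < k → {S : VSet} → MinimalDominating S → S ≐ Uset k r ⊎ In𝒳 k r S
  MinimalDominating⇒≐U⊎In𝒳 0<k M with Dominating⇒U⊆⊎𝒳-subset (proj₁ M)
  ... | inj₁ U⊆S = inj₁ (≐-sym (MinimalDominating-⊆ M U⊆S (U-Dominating 0<k)))
  ... | inj₂ (T , T∈𝒳 , T⊆S) =
    inj₂ (In𝒳-resp-≐ (MinimalDominating-⊆ M T⊆S (In𝒳⇒Dominating T∈𝒳)) T∈𝒳)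

  γ≡suc-r : suc r ≤ k → IsDominationNumber (suc r)
  γ≡suc-r r<k = (X nothing (λ _ → fromℕ< r<k) , In𝒳⇒Dominating 𝒳-member , In𝒳⇒∣∣≡ 𝒳-member) ,
                λ T → Dominating⇒suc-r≤∣∣ r<k
    where
    𝒳-member : In𝒳 k r (X nothing (λ _ → fromℕ< r<k))
    𝒳-member = X-In𝒳 nothing _

  Γ≡k : suc r ≤ k → 0 < r → IsUpperDominationNumber k
  Γ≡k r<k 0<r = (Uset k r , U-MinimalDominating 0<k 0<r , ∣U∣≡k) , ∣∣≤k
    where
    0<k : 0 < k
    0<k = m<n⇒0<n r<k
    ∣∣≤k : ∀ S → MinimalDominating S → ∣ S ∣ˢ ≤ k
    ∣∣≤k S M with MinimalDominating⇒≐U⊎In𝒳 0<k M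
    ... | inj₁ S≐U  = ≤-reflexive (trans (∣∣-resp-≐ S≐U) ∣U∣≡k)
    ... | inj₂ S∈𝒳 = subst (_≤ k) (sym (In𝒳⇒∣∣≡ S∈𝒳)) r<k

  γSet⇔≐U⊎In𝒳 : suc r ≤ k → ∀ S → γSet S ⇔ ((S ≐ Uset k r × k ≡ suc r) ⊎ In𝒳 k r S)
  γSet⇔≐U⊎In𝒳 r<k S = ⇔-trans (γSet⇔ (γ≡suc-r r<k) S) (mk⇔ to from)
    where
    to : Dominating S × ∣ S ∣ˢ ≡ suc r → (S ≐ Uset k r × k ≡ suc r) ⊎ In𝒳 k r S
    to (D , ∣S∣≡) with Dominating⇒U⊆⊎𝒳-subset D
    ... | inj₁ U⊆S = inj₁ (≐-sym (⊆∧∣∣≥⇒≐ allVtx-complete U⊆S ∣S∣≤∣U∣) , k≡suc-r)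
      where
      k≡suc-r : k ≡ suc r
      k≡suc-r = ≤-antisym (subst₂ _≤_ ∣U∣≡k ∣S∣≡ (⊆⇒∣∣≤ U⊆S)) r<k
      ∣S∣≤∣U∣ : ∣ S ∣ˢ ≤ ∣ Uset k r ∣ˢ
      ∣S∣≤∣U∣ = ≤-reflexive (trans ∣S∣≡ (sym (trans ∣U∣≡k k≡suc-r)))
    ... | inj₂ (T , T∈𝒳 , T⊆S) =
      inj₂ (In𝒳-resp-≐ (⊆∧∣∣≥⇒≐ allVtx-complete T⊆S ∣S∣≤∣T∣) T∈𝒳)
      where
      ∣S∣≤∣T∣ : ∣ S ∣ˢ ≤ ∣ T ∣ˢ
      ∣S∣≤∣T∣ = ≤-reflexive (trans ∣S∣≡ (sym (In𝒳⇒∣∣≡ T∈𝒳)))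
    from : (S ≐ Uset k r × k ≡ suc r) ⊎ In𝒳 k r S → Dominating S × ∣ S ∣ˢ ≡ suc r
    from (inj₁ (S≐U , k≡suc-r)) =
      Dominating-mono (≐⇒⊆ (≐-sym S≐U)) (U-Dominating (m<n⇒0<n r<k)) ,
      trans (∣∣-resp-≐ S≐U) (trans ∣U∣≡k k≡suc-r)
    from (inj₂ S∈𝒳) = In𝒳⇒Dominating S∈𝒳 , In𝒳⇒∣∣≡ S∈𝒳

  ΓSet⇔≐U⊎In𝒳 : suc r ≤ k → 0 < r → ∀ S → ΓSet S ⇔ (S ≐ Uset k r ⊎ (In𝒳 k r S × suc r ≡ k))
  ΓSet⇔≐U⊎In𝒳 r<k 0<r S = ⇔-trans (ΓSet⇔ (Γ≡k r<k 0<r) S) (mk⇔ to from)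
    where
    0<k : 0 < k
    0<k = m<n⇒0<n r<k
    to : MinimalDominating S × ∣ S ∣ˢ ≡ k → S ≐ Uset k r ⊎ (In𝒳 k r S × suc r ≡ k)
    to (M , ∣S∣≡k) =
      map₂ (λ S∈𝒳 → S∈𝒳 , trans (sym (In𝒳⇒∣∣≡ S∈𝒳)) ∣S∣≡k) (MinimalDominating⇒≐U⊎In𝒳 0<k M)
    from : S ≐ Uset k r ⊎ (In𝒳 k r S × suc r ≡ k) → MinimalDominating S × ∣ S ∣ˢ ≡ k
    from (inj₁ S≐U) =
      MinimalDominating-resp-≐ (≐-sym S≐U) (U-MinimalDominating 0<k 0<r) ,
      trans (∣∣-resp-≐ S≐U) ∣U∣≡k
    from (inj₂ (S∈𝒳 , suc-r≡k)) = In𝒳⇒MinimalDominating r<k S∈𝒳 , trans (In𝒳⇒∣∣≡ S∈𝒳) suc-r≡k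

lemma7 : (k r : ℕ) → 3 ≤ k → 1 ≤ r → r ≤ k ∸ 1 →
  (r < k ∸ 1 →
      (∀ S → G.ΓSet k r S ⇔ G._≐_ k r S (Uset k r))
    × (∀ S → G.γSet k r S ⇔ In𝒳 k r S))
  × (r ≡ k ∸ 1 →
      G.WellDominated k r
    × (∀ S → G.γSet k r S ⇔ (In𝒳 k r S ⊎ G._≐_ k r S (Uset k r)))
    × (∀ S → G.ΓSet k r S ⇔ (In𝒳 k r S ⊎ G._≐_ k r S (Uset k r))))
  × (∀ S → G.MinimalDominating k r S → G._≐_ k r S (Uset k r) ⊎ In𝒳 k r S)
lemma7 (suc k′) r _ 0<r r≤k′ = r<k′-case , r≡k′-case , λ _ → MinimalDominating⇒≐U⊎In𝒳 (s≤s z≤n)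
  where
  k = suc k′
  open G k r
  open Properties k r
  r<k : suc r ≤ k
  r<k = s≤s r≤k′
  r<k′-case : r < k′ → (∀ S → ΓSet S ⇔ S ≐ Uset k r) × (∀ S → γSet S ⇔ In𝒳 k r S)
  r<k′-case r<k′ =
    (λ S → ⇔-trans (ΓSet⇔≐U⊎In𝒳 r<k 0<r S)
             (mk⇔ (fromInj₁ λ (_ , r≡k′) → ⊥-elim (<-irrefl (suc-injective r≡k′) r<k′)) inj₁)) ,
    (λ S → ⇔-trans (γSet⇔≐U⊎In𝒳 r<k S)
             (mk⇔ (fromInj₂ λ (_ , k′≡r) → ⊥-elim (<-irrefl (sym (suc-injective k′≡r)) r<k′)) inj₂))
  r≡k′-case : r ≡ k′ → WellDominated
    × (∀ S → γSet S ⇔ (In𝒳 k r S ⊎ S ≐ Uset k r)) × (∀ S → ΓSet S ⇔ (In𝒳 k r S ⊎ S ≐ Uset k r))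
  r≡k′-case refl =
    (suc r , γ≡suc-r r<k , Γ≡k r<k 0<r) ,
    (λ S → ⇔-trans (γSet⇔≐U⊎In𝒳 r<k S) (mk⇔ (swap ∘ map₁ proj₁) (map₁ (_, refl) ∘ swap))) ,
    (λ S → ⇔-trans (ΓSet⇔≐U⊎In𝒳 r<k 0<r S) (mk⇔ (swap ∘ map₂ proj₁) (map₂ (_, refl) ∘ swap)))
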